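{- Consider the algorithm TreeWalk described in the context, run on a tree $\mathcal{T}$ with unknown target vertex $t$ in the vertex query model. For a configuration consisting of the current query vertex $q$ and counters $c(\cdot)$, define $\Phi_t=d(t,q)-c(t)+\sum_{v\neq t}c(v)$, where $d$ is the graph distance in $\mathcal{T}$. For every iteration: if the response in that iteration is correct, then the value of $\Phi_t$ after the iteration equals its value before the iteration minus $1$; if the response is incorrect, then the value after is at most the value before plus $1$.
   Context: Vertex query model: $\mathcal{T}$ is a known tree and $t$ an unknown target vertex; a correct response to querying $v$ is $v$ if $v=t$ and otherwise the neighbor of $v$ on the path to $t$; an incorrect response is some other vertex among $v$ and its neighbors. TreeWalk: initialize $c(v)=0$ for all vertices and let $q$ be an arbitrary vertex; in each iteration, query $q$ and let $r$ be the response; if $r=q$, increment $c(q)$; else if $c(q)>0$, decrement $c(q)$; else set $q\leftarrow r$. (The algorithm runs for $\max\!\big(\frac{2(D+1)}{2p-1},\frac{8\ln(1/\delta)}{(2p-1)^2}\big)$ iterations and returns $q$, where $D$ is the diameter of $\mathcal{T}$.) -}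

module Defs where

open import Data.Nat using (ℕ; zero; suc; _≤_; _∸_)
open import Data.Integer as ℤ using (ℤ; +_)
open import Data.Fin using (Fin; _≟_)
open import Data.List using (List; []; _∷_; map)
open import Data.Nat.ListAction using (sum)
open import Data.List.Relation.Unary.Unique.Propositional using (Unique)
open import Data.Product using (Σ; _×_; _,_; ∃)
open import Data.Sum using (_⊎_)
open import Relation.Binary.PropositionalEquality using (_≡_; _≢_)
open import Relation.Nullary using (¬_; yes; no)
open import Data.Bool using (if_then_else_)
open import Relation.Nullary.Decidable using (⌊_⌋)
open import Data.List using (allFin)

record Graph (n : ℕ) : Set₁ where
  field
    Adj   : Fin n → Fin n → Set
    sym   : ∀ {u v} → Adj u v → Adj v u
    irrefl : ∀ {u} → ¬ Adj u u
open Graph public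

module _ {n : ℕ} (G : Graph n) where

  data Walk : Fin n → Fin n → ℕ → Set where
    [_]  : (u : Fin n) → Walk u u 0
    _∷ʷ_ : ∀ {u w v k} → Adj G u w → Walk w v k → Walk u v (suc k)

  verts : ∀ {u v k} → Walk u v k → List (Fin n)
  verts [ u ] = u ∷ []
  verts (_∷ʷ_ {u = u} _ w) = u ∷ verts w

  IsPath : ∀ {u v k} → Walk u v k → Set
  IsPath w = Unique (verts w)

  IsCycle : ∀ {u k} → Walk u u k → Set
  IsCycle {k = k} w = (3 ≤ k) × Unique (ltail' (verts w))
    where
    ltail' : List (Fin n) → List (Fin n)
    ltail' [] = []
    ltail' (_ ∷ xs) = xs

  Connected : Set
  Connected = ∀ u v → ∃ λ k → Walk u v k

  Acyclic : Set
  Acyclic = ∀ {u k} (w : Walk u u k) → ¬ IsCycle w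

  IsTree : Set
  IsTree = Connected × Acyclic

  Dist : Fin n → Fin n → ℕ → Set
  Dist u v k = Walk u v k × (∀ {m} → Walk u v m → k ≤ m)

  -- the correct response to a query at v when the target is t:
  -- v itself if v = t, otherwise the neighbour of v on the path from v to t
  CorrectResp : (t v r : Fin n) → Set
  CorrectResp t v r =
      (v ≡ t × r ≡ v)
    ⊎ (v ≢ t × Σ (Adj G v r) λ a → ∃ λ k → Σ (Walk r t k) λ w → IsPath (a ∷ʷ w))

  IncorrectResp : (t v r : Fin n) → Set
  IncorrectResp t v r = (r ≡ v ⊎ Adj G v r) × ¬ CorrectResp t v r

record Config (n : ℕ) : Set where
  constructor ⟨_,_⟩
  field
    query : Fin n
    count : Fin n → ℕ
open Config public

update : ∀ {n} → (Fin n → ℕ) → Fin n → ℕ → (Fin n → ℕ)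
update c x a y = if ⌊ y ≟ x ⌋ then a else c y

step : ∀ {n} → Config n → Fin n → Config n
step ⟨ q , c ⟩ r with r ≟ q | c q
... | yes _ | m     = ⟨ q , update c q (suc m) ⟩
... | no _  | suc m = ⟨ q , update c q m ⟩
... | no _  | zero  = ⟨ r , c ⟩

sumExcept : ∀ {n} → (Fin n → ℕ) → Fin n → ℕ
sumExcept {n} c t = sum (map (λ v → if ⌊ v ≟ t ⌋ then 0 else c v) (allFin n))

-- Φ_t = d(t,q) − c(t) + Σ_{v≠t} c(v), where d = d(t,q) is supplied
Φ : ∀ {n} → Fin n → ℕ → Config n → ℤ
Φ t d cfg = (+ d ℤ.- + count cfg t) ℤ.+ + sumExcept (count cfg) t

module Submission where

-- One TreeWalk iteration changes Φ_t = d(t,q) − c(t) + Σ_{v≠t} c(v) in one of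
-- three ways, according to the branch of `step` taken:
--   * r = q: c(q) is incremented; Φ_t drops by 1 if q = t and rises by 1 otherwise;
--   * r ≠ q, c(q) > 0: c(q) is decremented; Φ_t rises by 1 if q = t, drops by 1 otherwise;
--   * r ≠ q, c(q) = 0: the query moves to the neighbour r, so Φ_t changes by d(t,r) − d(t,q).
-- A correct response can only take the "good" direction of each branch: it is r = q
-- exactly when q = t, and when q ≠ t it is the neighbour of q towards t, for which
-- d(t,r) = d(t,q) − 1.  Any response is q or a neighbour of q, so d(t,r) ≤ d(t,q) + 1.

open import Defs
open import Data.Nat using (ℕ; zero; suc; _+_; _≤_; z≤n; s≤s)
open import Data.Integer as ℤ using (ℤ; +_)
open import Data.Fin using (Fin; _≟_)
open import Data.Product using (_×_; Σ; _,_)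
import Data.Nat.Properties as ℕP
import Data.Integer.Properties as ℤP
import Data.Integer.Tactic.RingSolver as ℤSolver
import Data.Nat.Tactic.RingSolver as ℕSolver
open import Data.List using (_∷_; map; allFin)
open import Data.Nat.ListAction using (sum)
open import Data.List.Properties using (map-cong; map-cong-local)
open import Data.List.Membership.Propositional using (_∈_)
open import Data.List.Membership.Propositional.Properties using (∈-allFin)
open import Data.List.Relation.Unary.Any using (here; there)
open import Data.List.Relation.Unary.All as All using ([])
open import Data.List.Relation.Unary.All.Properties using (¬Any⇒All¬; All¬⇒¬Any)
open import Data.List.Relation.Unary.Unique.Propositional using (Unique)
open import Data.List.Relation.Unary.Unique.Propositional.Properties using (allFin⁺)
open import Data.List.Relation.Unary.AllPairs using ([]; _∷_)
open import Data.Sum using (inj₁; inj₂)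
open import Data.Unit using (⊤; tt)
open import Data.Empty using (⊥; ⊥-elim)
open import Relation.Nullary using (¬_; Dec; yes; no)
open import Relation.Nullary.Decidable using (⌊_⌋)
open import Data.Bool using (if_then_else_)
open import Relation.Binary.PropositionalEquality
  using (_≡_; _≢_; refl; trans; cong; cong₂; subst; module ≡-Reasoning)
  renaming (sym to ≡-sym)

module Walks {n : ℕ} (G : Graph n) where
  open import Data.List.Membership.DecPropositional (_≟_ {n}) using (_∈?_)

  _++ʷ_ : ∀ {u v w k l} → Walk G u v k → Walk G v w l → Walk G u w (k + l)
  [ _ ] ++ʷ q = q
  (a ∷ʷ p) ++ʷ q = a ∷ʷ (p ++ʷ q)

  snoc : ∀ {u v w k} → Walk G u v k → Adj G v w → Walk G u w (suc k)
  snoc [ _ ] a = a ∷ʷ [ _ ]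
  snoc (e ∷ʷ p) a = e ∷ʷ snoc p a

  head∈ : ∀ {u v k} (p : Walk G u v k) → u ∈ verts G p
  head∈ [ _ ] = here refl
  head∈ (_ ∷ʷ _) = here refl

  split-at : ∀ {u v k x} (p : Walk G u v k) → x ∈ verts G p →
             Σ ℕ λ k₁ → Σ ℕ λ k₂ → Walk G u x k₁ × Walk G x v k₂ × (k₁ + k₂ ≡ k)
  split-at [ u ] (here refl) = 0 , 0 , [ u ] , [ u ] , refl
  split-at (a ∷ʷ p) (here refl) = 0 , _ , [ _ ] , a ∷ʷ p , refl
  split-at (a ∷ʷ p) (there x∈p) with split-at p x∈p
  ... | k₁ , k₂ , p₁ , p₂ , k₁+k₂≡k = suc k₁ , k₂ , a ∷ʷ p₁ , p₂ , cong suc k₁+k₂≡k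

  distinct-ends-length : ∀ {u v k} → u ≢ v → Walk G u v k → 1 ≤ k
  distinct-ends-length u≢v [ _ ] = ⊥-elim (u≢v refl)
  distinct-ends-length u≢v (_ ∷ʷ _) = s≤s z≤n

  AllSteps : (Fin n → Fin n → Set) → ∀ {u v k} → Walk G u v k → Set
  AllSteps P [ _ ] = ⊤
  AllSteps P (_∷ʷ_ {u = u} {w = w} _ p) = P u w × AllSteps P p

  AllSteps-++ : ∀ {P u v w k l} (p : Walk G u v k) (q : Walk G v w l) →
                AllSteps P p → AllSteps P q → AllSteps P (p ++ʷ q)
  AllSteps-++ [ _ ] q _ Pq = Pq
  AllSteps-++ (_ ∷ʷ p) q (Pstep , Pp) Pq = Pstep , AllSteps-++ p q Pp Pq

  NotStep : Fin n → Fin n → Fin n → Fin n → Set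
  NotStep x y u w = u ≡ x → w ≡ y → ⊥

  avoids-into : ∀ {x y u v k} (p : Walk G u v k) → ¬ (y ∈ verts G p) → AllSteps (NotStep x y) p
  avoids-into [ _ ] _ = tt
  avoids-into (_ ∷ʷ p) y∉ =
    (λ _ w≡y → y∉ (there (subst (_∈ verts G p) w≡y (head∈ p)))) , avoids-into p (λ y∈ → y∉ (there y∈))

  avoids-out-of : ∀ {x y u v k} (p : Walk G u v k) → ¬ (x ∈ verts G p) → AllSteps (NotStep x y) p
  avoids-out-of [ _ ] _ = tt
  avoids-out-of (_ ∷ʷ p) x∉ = (λ u≡x _ → x∉ (here (≡-sym u≡x))) , avoids-out-of p (λ x∈ → x∉ (there x∈))

  PathWith : (Fin n → Fin n → Set) → Fin n → Fin n → Set
  PathWith P u v = Σ ℕ λ k → Σ (Walk G u v k) λ p → IsPath G p × AllSteps P p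

  suffix-from : ∀ {P u v k x} (p : Walk G u v k) → x ∈ verts G p →
                IsPath G p → AllSteps P p → PathWith P x v
  suffix-from [ u ] (here refl) path Pp = 0 , [ u ] , path , Pp
  suffix-from (e ∷ʷ p) (here refl) path Pp = _ , e ∷ʷ p , path , Pp
  suffix-from (_ ∷ʷ p) (there x∈p) (_ ∷ path) (_ , Pp) = suffix-from p x∈p path Pp

  loop-erase : ∀ {P u v k} (p : Walk G u v k) → AllSteps P p → PathWith P u v
  loop-erase [ u ] _ = 0 , [ u ] , [] ∷ [] , tt
  loop-erase (_∷ʷ_ {u = u} e p) (Pe , Pp) with loop-erase p Pp
  ... | k , q , path , Pq with u ∈? verts G q
  ...   | yes u∈q = suffix-from q u∈q path Pq
  ...   | no u∉q = suc k , e ∷ʷ q , ¬Any⇒All¬ (verts G q) u∉q ∷ path , Pe , Pq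

  module _ (acyclic : Acyclic G) where
    no-detour : ∀ {q r} → Adj G q r → ¬ PathWith (NotStep r q) r q
    no-detour a (_ , [ _ ] , _ , _) = irrefl G a
    no-detour a (_ , _ ∷ʷ [ _ ] , _ , (r→q-free , _)) = r→q-free refl refl
    no-detour a (_ , e ∷ʷ (e′ ∷ʷ p) , path , _) = acyclic (a ∷ʷ (e ∷ʷ (e′ ∷ʷ p))) (s≤s (s≤s (s≤s z≤n)) , path)

    next-on-every-walk : ∀ {q r t k m} (a : Adj G q r) (w : Walk G r t k) → IsPath G (a ∷ʷ w) →
                         (W : Walk G t q m) → r ∈ verts G W
    next-on-every-walk {q} {r} a w (q∉w ∷ _) W with r ∈? verts G W
    ... | yes r∈W = r∈W
    ... | no r∉W = ⊥-elim (no-detour a (loop-erase (w ++ʷ W) detour-free))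
      where
      detour-free : AllSteps (NotStep r q) (w ++ʷ W)
      detour-free = AllSteps-++ w W (avoids-into w (All¬⇒¬Any q∉w)) (avoids-out-of W r∉W)

  dist-unique : ∀ {u v d d′} → Dist G u v d → Dist G u v d′ → d ≡ d′
  dist-unique (p , p-min) (p′ , p′-min) = ℕP.≤-antisym (p-min p′) (p′-min p)

  dist-neighbour : ∀ {t v w d d′} → Dist G t v d → Adj G v w → Dist G t w d′ → d′ ≤ suc d
  dist-neighbour (p , _) a (_ , p′-min) = p′-min (snoc p a)

  dist-towards : Acyclic G → ∀ {q r t k d d′} (a : Adj G q r) (w : Walk G r t k) →
                 IsPath G (a ∷ʷ w) → Dist G t q d → Dist G t r d′ → d ≡ suc d′
  dist-towards acyclic a w path Dq@(W , _) Dr@(_ , Wr-min)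
    with split-at W (next-on-every-walk acyclic a w path W)
  ... | k₁ , k₂ , W₁ , W₂ , k₁+k₂≡d = ℕP.≤-antisym
    (dist-neighbour Dr (Graph.sym G a) Dq)
    (begin
      suc _     ≡⟨ ℕP.+-comm 1 _ ⟩
      _ + 1     ≤⟨ ℕP.+-mono-≤ (Wr-min W₁) (distinct-ends-length r≢q W₂) ⟩
      k₁ + k₂   ≡⟨ k₁+k₂≡d ⟩
      _         ∎)
    where
    open ℕP.≤-Reasoning
    r≢q : _ ≢ _
    r≢q r≡q = irrefl G (subst (Adj G _) r≡q a)

-- Changing f at a single point v of a duplicate-free list changes the sum of
-- the list by exactly the change at v (stated additively to stay within ℕ).
sum-map-point-change : ∀ {A : Set} (f g : A → ℕ) (v : A) → (∀ x → x ≢ v → f x ≡ g x) →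
                       ∀ xs → Unique xs → v ∈ xs → sum (map f xs) + g v ≡ sum (map g xs) + f v
sum-map-point-change f g v f≡g (x ∷ xs) (v∉xs ∷ _) (here refl) = begin
  (f x + sum (map f xs)) + g x   ≡⟨ cong (λ s → (f x + s) + g x) rest-equal ⟩
  (f x + sum (map g xs)) + g x   ≡⟨ swap (f x) (g x) (sum (map g xs)) ⟩
  (g x + sum (map g xs)) + f x   ∎
  where
  open ≡-Reasoning
  rest-equal : sum (map f xs) ≡ sum (map g xs)
  rest-equal = cong sum (map-cong-local (All.map (λ v≢y → f≡g _ (λ y≡v → v≢y (≡-sym y≡v))) v∉xs))
  swap : ∀ a b s → (a + s) + b ≡ (b + s) + a
  swap = ℕSolver.solve-∀
sum-map-point-change f g v f≡g (x ∷ xs) (x∉xs ∷ unique) (there v∈xs) = begin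
  (f x + sum (map f xs)) + g v   ≡⟨ ℕP.+-assoc (f x) _ (g v) ⟩
  f x + (sum (map f xs) + g v)   ≡⟨ cong₂ _+_ (f≡g x x≢v) (sum-map-point-change f g v f≡g xs unique v∈xs) ⟩
  g x + (sum (map g xs) + f v)   ≡⟨ ℕP.+-assoc (g x) _ (f v) ⟨
  (g x + sum (map g xs)) + f v   ∎
  where
  open ≡-Reasoning
  x≢v : x ≢ v
  x≢v = All.lookup x∉xs v∈xs

update-self : ∀ {n} (c : Fin n → ℕ) (x : Fin n) (a : ℕ) → update c x a x ≡ a
update-self c x a with x ≟ x
... | yes _ = refl
... | no x≢x = ⊥-elim (x≢x refl)

update-other : ∀ {n} (c : Fin n → ℕ) (x v : Fin n) (a : ℕ) → v ≢ x → update c x a v ≡ c v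
update-other c x v a v≢x with v ≟ x
... | yes v≡x = ⊥-elim (v≢x v≡x)
... | no _ = refl

masked : ∀ {n} → (Fin n → ℕ) → Fin n → Fin n → ℕ
masked c t v = if ⌊ v ≟ t ⌋ then 0 else c v

masked-away : ∀ {n} (c : Fin n → ℕ) (t v : Fin n) → v ≢ t → masked c t v ≡ c v
masked-away c t v v≢t with v ≟ t
... | yes v≡t = ⊥-elim (v≢t v≡t)
... | no _ = refl

sumExcept-update-target : ∀ {n} (c : Fin n → ℕ) (t : Fin n) (a : ℕ) →
                          sumExcept (update c t a) t ≡ sumExcept c t
sumExcept-update-target {n} c t a = cong sum (map-cong same-summand (allFin n))
  where
  same-summand : ∀ v → masked (update c t a) t v ≡ masked c t v
  same-summand v with v ≟ t
  ... | yes _ = refl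
  ... | no _ = refl

sumExcept-update-other : ∀ {n} (c : Fin n → ℕ) (t v : Fin n) (a : ℕ) → v ≢ t →
                         sumExcept (update c v a) t + c v ≡ sumExcept c t + a
sumExcept-update-other {n} c t v a v≢t = begin
  sumExcept (update c v a) t + c v                   ≡⟨ cong (λ m → sumExcept (update c v a) t + m) (masked-away c t v v≢t) ⟨
  sumExcept (update c v a) t + masked c t v          ≡⟨ sum-map-point-change (masked (update c v a) t) (masked c t) v
                                                          agree (allFin n) (allFin⁺ n) (∈-allFin v) ⟩
  sumExcept c t + masked (update c v a) t v          ≡⟨ cong (λ m → sumExcept c t + m) new-value ⟩
  sumExcept c t + a                                  ∎
  where
  open ≡-Reasoning
  agree : ∀ x → x ≢ v → masked (update c v a) t x ≡ masked c t x
  agree x x≢v = cong (λ m → if ⌊ x ≟ t ⌋ then 0 else m) (update-other c v x a x≢v)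
  new-value : masked (update c v a) t v ≡ a
  new-value = trans (masked-away (update c v a) t v v≢t) (update-self c v a)

counter-down : ∀ x m → x ℤ.+ (+ m ℤ.- + suc m) ≡ x ℤ.- + 1
counter-down x m rewrite ℤP.pos-+ 1 m = ring x (+ m)
  where
  ring : ∀ x y → x ℤ.+ (y ℤ.- (+ 1 ℤ.+ y)) ≡ x ℤ.- + 1
  ring = ℤSolver.solve-∀

counter-up : ∀ x m → x ℤ.+ (+ suc m ℤ.- + m) ≡ x ℤ.+ + 1
counter-up x m rewrite ℤP.pos-+ 1 m = ring x (+ m)
  where
  ring : ∀ x y → x ℤ.+ ((+ 1 ℤ.+ y) ℤ.- y) ≡ x ℤ.+ + 1
  ring = ℤSolver.solve-∀

transpose : ∀ x y a b → x ℤ.+ b ≡ y ℤ.+ a → x ≡ y ℤ.+ (a ℤ.- b)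
transpose x y a b x+b≡y+a = begin
  x                       ≡⟨ ring₁ x b ⟩
  (x ℤ.+ b) ℤ.- b         ≡⟨ cong (ℤ._- b) x+b≡y+a ⟩
  (y ℤ.+ a) ℤ.- b         ≡⟨ ring₂ y a b ⟩
  y ℤ.+ (a ℤ.- b)         ∎
  where
  open ≡-Reasoning
  ring₁ : ∀ x b → x ≡ (x ℤ.+ b) ℤ.- b
  ring₁ = ℤSolver.solve-∀
  ring₂ : ∀ y a b → (y ℤ.+ a) ℤ.- b ≡ y ℤ.+ (a ℤ.- b)
  ring₂ = ℤSolver.solve-∀

Φ-update-target : ∀ {n} {t v : Fin n} {c : Fin n → ℕ} {d a b : ℕ} → v ≡ t → c v ≡ b →
                  Φ t d ⟨ v , update c v a ⟩ ≡ Φ t d ⟨ v , c ⟩ ℤ.+ (+ b ℤ.- + a)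
Φ-update-target {t = t} {c = c} {d} {a} refl refl
  rewrite update-self c t a | sumExcept-update-target c t a = ring (+ d) (+ a) (+ c t) (+ sumExcept c t)
  where
  ring : ∀ D A B S → (D ℤ.- A) ℤ.+ S ≡ ((D ℤ.- B) ℤ.+ S) ℤ.+ (B ℤ.- A)
  ring = ℤSolver.solve-∀

Φ-update-other : ∀ {n} {t v : Fin n} {c : Fin n → ℕ} {d a b : ℕ} → v ≢ t → c v ≡ b →
                 Φ t d ⟨ v , update c v a ⟩ ≡ Φ t d ⟨ v , c ⟩ ℤ.+ (+ a ℤ.- + b)
Φ-update-other {t = t} {v} {c = c} {d} {a} v≢t refl
  rewrite update-other c v t a (λ t≡v → v≢t (≡-sym t≡v)) = begin
    (+ d ℤ.- + c t) ℤ.+ + S′                           ≡⟨ cong (ℤ._+_ (+ d ℤ.- + c t)) S′≡S+a-b ⟩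
    (+ d ℤ.- + c t) ℤ.+ (+ S ℤ.+ (+ a ℤ.- + c v))     ≡⟨ ℤP.+-assoc (+ d ℤ.- + c t) (+ S) _ ⟨
    ((+ d ℤ.- + c t) ℤ.+ + S) ℤ.+ (+ a ℤ.- + c v)     ∎
  where
  open ≡-Reasoning
  S′ S : ℕ
  S′ = sumExcept (update c v a) t
  S = sumExcept c t
  S′≡S+a-b : + S′ ≡ + S ℤ.+ (+ a ℤ.- + c v)
  S′≡S+a-b = transpose (+ S′) (+ S) (+ a) (+ c v)
               (trans (≡-sym (ℤP.pos-+ S′ (c v)))
                 (trans (cong +_ (sumExcept-update-other c t v a v≢t)) (ℤP.pos-+ S a)))

Φ-distance-suc : ∀ {n} (t : Fin n) (d : ℕ) (cfg : Config n) → Φ t (suc d) cfg ≡ Φ t d cfg ℤ.+ + 1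
Φ-distance-suc t d cfg rewrite ℤP.pos-+ 1 d = ring (+ d) (+ count cfg t) (+ sumExcept (count cfg) t)
  where
  ring : ∀ D C S → ((+ 1 ℤ.+ D) ℤ.- C) ℤ.+ S ≡ ((D ℤ.- C) ℤ.+ S) ℤ.+ + 1
  ring = ℤSolver.solve-∀

Φ-distance-pred : ∀ {n} (t : Fin n) (d : ℕ) (cfg : Config n) → Φ t d cfg ≡ Φ t (suc d) cfg ℤ.- + 1
Φ-distance-pred t d cfg rewrite Φ-distance-suc t d cfg = ring (Φ t d cfg)
  where
  ring : ∀ x → x ≡ (x ℤ.+ + 1) ℤ.- + 1
  ring = ℤSolver.solve-∀

Φ-distance-mono : ∀ {n} (t : Fin n) {d d′ : ℕ} (cfg : Config n) → d ≤ d′ → Φ t d cfg ℤ.≤ Φ t d′ cfg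
Φ-distance-mono t cfg d≤d′ =
  ℤP.+-monoˡ-≤ (+ sumExcept (count cfg) t) (ℤP.+-monoˡ-≤ (ℤ.- + count cfg t) (ℤ.+≤+ d≤d′))

module _ {n : ℕ} (T : Graph n) (t : Fin n) where
  open Walks T

  correct-decreases : Acyclic T → (cfg : Config n) (r : Fin n) (d d′ : ℕ) →
                      Dist T t (query cfg) d → Dist T t (query (step cfg r)) d′ →
                      CorrectResp T t (query cfg) r → Φ t d′ (step cfg r) ≡ Φ t d cfg ℤ.- + 1
  correct-decreases acyclic ⟨ q , c ⟩ r d d′ Dq Dr correct with r ≟ q | c q in cq≡ | correct
  ... | yes refl | m | inj₁ (q≡t , _) rewrite dist-unique Dr Dq =
    trans (Φ-update-target q≡t cq≡) (counter-down (Φ t d ⟨ q , c ⟩) m)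
  ... | yes refl | _ | inj₂ (_ , q-q , _) = ⊥-elim (irrefl T q-q)
  ... | no r≢q | _ | inj₁ (_ , r≡q) = ⊥-elim (r≢q r≡q)
  ... | no _ | suc m | inj₂ (q≢t , _) rewrite dist-unique Dr Dq =
    trans (Φ-update-other q≢t cq≡) (counter-down (Φ t d ⟨ q , c ⟩) m)
  ... | no _ | zero | inj₂ (_ , q-r , _ , w , path) rewrite dist-towards acyclic q-r w path Dq Dr =
    Φ-distance-pred t d′ ⟨ q , c ⟩

  incorrect-increases : (cfg : Config n) (r : Fin n) (d d′ : ℕ) →
                        Dist T t (query cfg) d → Dist T t (query (step cfg r)) d′ →
                        IncorrectResp T t (query cfg) r → Φ t d′ (step cfg r) ℤ.≤ Φ t d cfg ℤ.+ + 1
  incorrect-increases ⟨ q , c ⟩ r d d′ Dq Dr (response , incorrect) with r ≟ q | c q in cq≡ | response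
  ... | yes refl | m | _ rewrite dist-unique Dr Dq = ℤP.≤-reflexive
    (trans (Φ-update-other q≢t cq≡) (counter-up (Φ t d ⟨ q , c ⟩) m))
    where
    q≢t : q ≢ t
    q≢t q≡t = incorrect (inj₁ (q≡t , refl))
  ... | no _ | suc m | _ rewrite dist-unique Dr Dq = decrement (q ≟ t)
    where
    decrement : Dec (q ≡ t) → Φ t d ⟨ q , update c q m ⟩ ℤ.≤ Φ t d ⟨ q , c ⟩ ℤ.+ + 1
    decrement (yes q≡t) = ℤP.≤-reflexive (trans (Φ-update-target q≡t cq≡) (counter-up (Φ t d ⟨ q , c ⟩) m))
    decrement (no q≢t) = begin
      Φ t d ⟨ q , update c q m ⟩   ≡⟨ trans (Φ-update-other q≢t cq≡) (counter-down (Φ t d ⟨ q , c ⟩) m) ⟩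
      Φ t d ⟨ q , c ⟩ ℤ.- + 1      ≤⟨ ℤP.i-j≤i (Φ t d ⟨ q , c ⟩) (+ 1) ⟩
      Φ t d ⟨ q , c ⟩              ≤⟨ ℤP.i≤i+j (Φ t d ⟨ q , c ⟩) (+ 1) ⟩
      Φ t d ⟨ q , c ⟩ ℤ.+ + 1      ∎
      where open ℤP.≤-Reasoning
  ... | no r≢q | zero | inj₁ r≡q = ⊥-elim (r≢q r≡q)
  ... | no _ | zero | inj₂ q-r = ℤP.≤-trans (Φ-distance-mono t ⟨ q , c ⟩ (dist-neighbour Dq q-r Dr))
                                          (ℤP.≤-reflexive (Φ-distance-suc t d ⟨ q , c ⟩))

lemma16 : ∀ {n} (T : Graph n) → IsTree T →
          (t : Fin n) (cfg : Config n) (r : Fin n) (d d′ : ℕ) →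
          Dist T t (query cfg) d → Dist T t (query (step cfg r)) d′ →
          (CorrectResp T t (query cfg) r →
             Φ t d′ (step cfg r) ≡ Φ t d cfg ℤ.- + 1)
          × (IncorrectResp T t (query cfg) r →
             Φ t d′ (step cfg r) ℤ.≤ Φ t d cfg ℤ.+ + 1)
lemma16 T (_ , acyclic) t cfg r d d′ Dq Dr =
  correct-decreases T t acyclic cfg r d d′ Dq Dr , incorrect-increases T t cfg r d d′ Dq Dr
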